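{- Let $A,B,C,D$ be distributive lattices and $g\colon A\to C$, $f\colon A\to B$, $v\colon C\to D$, $u\colon B\to D$ lattice homomorphisms with $u\circ f\le v\circ g$ pointwise. Then the lax square $(f,g,u,v)$ has the interpolation property if, and only if, the dual lax square of Priestley spaces, consisting of $v_*\colon D_*\to C_*$, $u_*\colon D_*\to B_*$, $g_*\colon C_*\to A_*$, $f_*\colon B_*\to A_*$ (which satisfies $f_*\circ u_*\le g_*\circ v_*$), has the interpolation property, i.e., for all $y\in B_*$, $z\in C_*$ with $f_*(y)\le g_*(z)$ there is $x\in D_*$ with $y\le u_*(x)$ and $v_*(x)\le z$.
   Context: Distributive lattices are bounded and homomorphisms preserve $\top,\bot$. For a distributive lattice $A$, $A_*$ is the set of lattice homomorphisms $A\to 2$, ordered pointwise ($x\le y$ iff $x(a)=1$ implies $y(a)=1$) and topologized as a subspace of $2^A$; for $h\colon A\to B$, $h_*(x)=x\circ h$. The lax square $(f,g,u,v)$ with $u\circ f\le v\circ g$ has the interpolation property if for all $b\in B$, $c\in C$ with $u(b)\le v(c)$ there is $a\in A$ with $b\le f(a)$ and $g(a)\le c$. -}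

module Defs where

open import Level using (Level; _⊔_; 0ℓ; Setω) renaming (suc to lsuc)
open import Data.Bool using (Bool; true; false)
import Data.Bool as B
open import Data.Bool.Properties using (∨-∧-isDistributiveLattice)
open import Data.Product using (Σ; _×_; _,_; ∃; proj₁; proj₂)
open import Relation.Binary.PropositionalEquality using (_≡_; refl; trans; cong)
open import Relation.Unary using (Pred; _∈_)
open import Relation.Nullary using (¬_)
open import Algebra.Definitions using (Identity)
open import Algebra.Lattice.Bundles using (DistributiveLattice)
open import Algebra.Lattice.Morphism.Structures using (module LatticeMorphisms)
open import Axiom.ExcludedMiddle using (ExcludedMiddle) public

record BDLattice (c ℓ : Level) : Set (lsuc (c ⊔ ℓ)) where
  field
    dl : DistributiveLattice c ℓ
  open DistributiveLattice dl public
  field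
    ⊤ : Carrier
    ⊥ : Carrier
    ∧-identity : Identity _≈_ ⊤ _∧_
    ∨-identity : Identity _≈_ ⊥ _∨_

  _≤_ : Carrier → Carrier → Set ℓ
  x ≤ y = (x ∧ y) ≈ x

open BDLattice using (Carrier)

record Hom {a ℓa b ℓb} (L : BDLattice a ℓa) (M : BDLattice b ℓb) : Set (a ⊔ b ⊔ ℓa ⊔ ℓb) where
  private
    module L = BDLattice L
    module M = BDLattice M
  field
    ⟦_⟧ : L.Carrier → M.Carrier
    isLatticeHomomorphism :
      LatticeMorphisms.IsLatticeHomomorphism L.rawLattice M.rawLattice ⟦_⟧
    ⊤-homo : ⟦ L.⊤ ⟧ M.≈ M.⊤
    ⊥-homo : ⟦ L.⊥ ⟧ M.≈ M.⊥

open Hom public using (⟦_⟧)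

𝟚 : BDLattice 0ℓ 0ℓ
𝟚 = record
  { dl = record { isDistributiveLattice = ∨-∧-isDistributiveLattice }
  ; ⊤ = true
  ; ⊥ = false
  ; ∧-identity = (λ _ → refl) , (λ { true → refl ; false → refl })
  ; ∨-identity = (λ _ → refl) , (λ { true → refl ; false → refl })
  }

_∘H_ : ∀ {a ℓa b ℓb c ℓc} {L : BDLattice a ℓa} {M : BDLattice b ℓb} {N : BDLattice c ℓc}
       → Hom M N → Hom L M → Hom L N
_∘H_ {L = L} {M} {N} g f = record
  { ⟦_⟧ = λ x → ⟦ g ⟧ (⟦ f ⟧ x)
  ; isLatticeHomomorphism = record
    { isRelHomomorphism = record { cong = λ p → gH.⟦⟧-cong (fH.⟦⟧-cong p) }
    ; ∧-homo = λ x y → N.trans (gH.⟦⟧-cong (fH.∧-homo x y)) (gH.∧-homo _ _)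
    ; ∨-homo = λ x y → N.trans (gH.⟦⟧-cong (fH.∨-homo x y)) (gH.∨-homo _ _)
    }
  ; ⊤-homo = N.trans (gH.⟦⟧-cong (Hom.⊤-homo f)) (Hom.⊤-homo g)
  ; ⊥-homo = N.trans (gH.⟦⟧-cong (Hom.⊥-homo f)) (Hom.⊥-homo g)
  }
  where
    module N = BDLattice N
    module fH = LatticeMorphisms.IsLatticeHomomorphism (Hom.isLatticeHomomorphism f)
    module gH = LatticeMorphisms.IsLatticeHomomorphism (Hom.isLatticeHomomorphism g)

_* : ∀ {a ℓa} → BDLattice a ℓa → Set (a ⊔ ℓa)
L * = Hom L 𝟚

dual : ∀ {a ℓa b ℓb} {L : BDLattice a ℓa} {M : BDLattice b ℓb}
       → Hom L M → M * → L *
dual h x = x ∘H h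

_≤*_ : ∀ {a ℓa} {L : BDLattice a ℓa} → L * → L * → Set a
_≤*_ {L = L} x y = ∀ (a : Carrier L) → ⟦ x ⟧ a ≡ true → ⟦ y ⟧ a ≡ true

_≤H_ : ∀ {a ℓa b ℓb} {L : BDLattice a ℓa} {M : BDLattice b ℓb}
       → Hom L M → Hom L M → Set (a ⊔ ℓb)
_≤H_ {L = L} {M} h k = ∀ (x : Carrier L) → BDLattice._≤_ M (⟦ h ⟧ x) (⟦ k ⟧ x)

InterpolationProperty :
  ∀ {a ℓa b ℓb c ℓc d ℓd}
    {A : BDLattice a ℓa} {B : BDLattice b ℓb} {C : BDLattice c ℓc} {D : BDLattice d ℓd}
  → (f : Hom A B) (g : Hom A C) (u : Hom B D) (v : Hom C D) → Set _
InterpolationProperty {A = A} {B} {C} {D} f g u v =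
  ∀ (b : Carrier B) (c : Carrier C) → BDLattice._≤_ D (⟦ u ⟧ b) (⟦ v ⟧ c)
  → Σ (Carrier A) λ a → BDLattice._≤_ B b (⟦ f ⟧ a) × BDLattice._≤_ C (⟦ g ⟧ a) c

DualInterpolationProperty :
  ∀ {a ℓa b ℓb c ℓc d ℓd}
    {A : BDLattice a ℓa} {B : BDLattice b ℓb} {C : BDLattice c ℓc} {D : BDLattice d ℓd}
  → (f : Hom A B) (g : Hom A C) (u : Hom B D) (v : Hom C D) → Set _
DualInterpolationProperty {A = A} {B} {C} {D} f g u v =
  ∀ (y : B *) (z : C *) → dual f y ≤* dual g z
  → Σ (D *) λ x → y ≤* dual u x × dual v x ≤* z

record IsFilter {a ℓa p} (L : BDLattice a ℓa) (F : Pred (Carrier L) p) : Set (a ⊔ ℓa ⊔ p) where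
  open BDLattice L
  field
    ⊤∈    : ⊤ ∈ F
    ∧-closed : ∀ {x y} → x ∈ F → y ∈ F → (x ∧ y) ∈ F
    up-closed : ∀ {x y} → x ≤ y → x ∈ F → y ∈ F

record IsIdeal {a ℓa p} (L : BDLattice a ℓa) (I : Pred (Carrier L) p) : Set (a ⊔ ℓa ⊔ p) where
  open BDLattice L
  field
    ⊥∈    : ⊥ ∈ I
    ∨-closed : ∀ {x y} → x ∈ I → y ∈ I → (x ∨ y) ∈ I
    down-closed : ∀ {x y} → x ≤ y → y ∈ I → x ∈ I

-- Prime filter theorem (a consequence of the Boolean prime ideal theorem, valid
-- in ZFC) for the lattice L: a filter and an ideal that are disjoint are
-- separated by a homomorphism L → 2.
PrimeFilterTheorem : ∀ {a ℓa} → BDLattice a ℓa → Setω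
PrimeFilterTheorem L =
  ∀ {p} (F I : Pred (Carrier L) p) → IsFilter L F → IsIdeal L I
  → (∀ x → x ∈ F → ¬ (x ∈ I))
  → Σ (L *) λ h → (∀ x → x ∈ F → ⟦ h ⟧ x ≡ true) × (∀ x → x ∈ I → ⟦ h ⟧ x ≡ false)

{-# OPTIONS --safe #-}
-- A point x of a lattice L is determined by the prime filter true-set x and its
-- complement, the prime ideal false-set x.  (⇒) Given y, z with f_* y ≤ g_* z, the
-- filter of D generated by u[true-set y] and the ideal generated by v[false-set z]
-- are disjoint: an element between u b and v c yields an interpolant a with
-- y (f a) = 1 and z (g a) = 0.  A point separating them is the required x.
-- (⇐) If b, c with u b ≤ v c had no interpolant, separating ↑ b from the ideal
-- generated by f[g⁻¹(↓ c)] gives y, and separating the filter generated by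
-- g[f⁻¹(true-set y)] from ↓ c gives z with f_* y ≤ g_* z, y b = 1 and z c = 0.
-- A dual interpolant x would give 1 = x (u b) ≤ x (v c) ≤ z c = 0.  Excluded middle
-- turns this contradiction into an interpolant.
module Submission where

open import Defs
open import Level using (Lift; lift; lower; _⊔_; 0ℓ)
open import Data.Bool using (true; false)
import Data.Bool.Properties as Bool
open import Data.Empty using (⊥-elim)
open import Data.Product using (Σ; ∃-syntax; _×_; _,_; proj₁; proj₂)
open import Function.Bundles using (_⇔_; mk⇔)
open import Relation.Binary.PropositionalEquality as ≡ using (_≡_)
open import Relation.Nullary using (¬_; yes; no)
open import Relation.Unary using (Pred; _∈_; _⊢_)
open import Algebra.Lattice.Morphism.Structures using (module LatticeMorphisms)
open import Algebra.Lattice.Properties.Lattice using (∨-∧-orderTheoreticLattice)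
import Relation.Binary.Lattice as Order
import Relation.Binary.Lattice.Properties.MeetSemilattice as MeetProperties
import Relation.Binary.Lattice.Properties.JoinSemilattice as JoinProperties

module LatticeOrder {a ℓ} (L : BDLattice a ℓ) where
  open BDLattice L

  -- x ≤ y is x ∧ y ≈ x, the converse of the library's natural order x ≈ x ∧ y.
  private
    module N = Order.Lattice (∨-∧-orderTheoreticLattice lattice)

  ≤-reflexive : ∀ {x y} → x ≈ y → x ≤ y
  ≤-reflexive x≈y = sym (N.reflexive x≈y)

  ≤-refl : ∀ {x} → x ≤ x
  ≤-refl = ≤-reflexive refl

  ≤-trans : ∀ {x y z} → x ≤ y → y ≤ z → x ≤ z
  ≤-trans x≤y y≤z = sym (N.trans (sym x≤y) (sym y≤z))

  x≤⊤ : ∀ {x} → x ≤ ⊤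
  x≤⊤ {x} = proj₂ ∧-identity x

  ⊥≤x : ∀ {x} → ⊥ ≤ x
  ⊥≤x {x} = ≤-trans (sym (N.x≤x∨y ⊥ x)) (≤-reflexive (proj₁ ∨-identity x))

  ∧-greatest : ∀ {x y z} → x ≤ y → x ≤ z → x ≤ (y ∧ z)
  ∧-greatest x≤y x≤z = sym (N.∧-greatest (sym x≤y) (sym x≤z))

  ∨-least : ∀ {x y z} → x ≤ z → y ≤ z → (x ∨ y) ≤ z
  ∨-least x≤z y≤z = sym (N.∨-least (sym x≤z) (sym y≤z))

  ∧-monotonic : ∀ {x y x′ y′} → x ≤ x′ → y ≤ y′ → (x ∧ y) ≤ (x′ ∧ y′)
  ∧-monotonic p q = sym (MeetProperties.∧-monotonic N.meetSemilattice (sym p) (sym q))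

  ∨-monotonic : ∀ {x y x′ y′} → x ≤ x′ → y ≤ y′ → (x ∨ y) ≤ (x′ ∨ y′)
  ∨-monotonic p q = sym (JoinProperties.∨-monotonic N.joinSemilattice (sym p) (sym q))

module Principal {a ℓ} (L : BDLattice a ℓ) where
  open BDLattice L
  open LatticeOrder L

  ↑_ : Carrier → Pred Carrier ℓ
  ↑ x = x ≤_

  ↓_ : Carrier → Pred Carrier ℓ
  ↓ x = _≤ x

  ↑-isFilter : ∀ x → IsFilter L (↑ x)
  ↑-isFilter x = record
    { ⊤∈ = x≤⊤
    ; ∧-closed = ∧-greatest
    ; up-closed = λ y≤z x≤y → ≤-trans x≤y y≤z
    }

  ↓-isIdeal : ∀ x → IsIdeal L (↓ x)
  ↓-isIdeal x = record
    { ⊥∈ = ⊥≤x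
    ; ∨-closed = ∨-least
    ; down-closed = ≤-trans
    }

module _ {a ℓa b ℓb} {L : BDLattice a ℓa} {M : BDLattice b ℓb} (h : Hom L M) where
  private
    module L = BDLattice L
    module M = BDLattice M
    module h = LatticeMorphisms.IsLatticeHomomorphism (Hom.isLatticeHomomorphism h)
  open LatticeOrder M

  hom-monotone : ∀ {x y} → x L.≤ y → ⟦ h ⟧ x M.≤ ⟦ h ⟧ y
  hom-monotone {x} {y} x≤y = M.trans (M.sym (h.∧-homo x y)) (h.⟦⟧-cong x≤y)

  preimage-isFilter : ∀ {p} {F : Pred M.Carrier p} → IsFilter M F → IsFilter L (⟦ h ⟧ ⊢ F)
  preimage-isFilter F-filter = record
    { ⊤∈ = up-closed (≤-reflexive (M.sym (Hom.⊤-homo h))) ⊤∈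
    ; ∧-closed = λ {x} {y} x∈F y∈F →
        up-closed (≤-reflexive (M.sym (h.∧-homo x y))) (∧-closed x∈F y∈F)
    ; up-closed = λ x≤y → up-closed (hom-monotone x≤y)
    }
    where open IsFilter F-filter

  preimage-isIdeal : ∀ {p} {I : Pred M.Carrier p} → IsIdeal M I → IsIdeal L (⟦ h ⟧ ⊢ I)
  preimage-isIdeal I-ideal = record
    { ⊥∈ = down-closed (≤-reflexive (Hom.⊥-homo h)) ⊥∈
    ; ∨-closed = λ {x} {y} x∈I y∈I →
        down-closed (≤-reflexive (h.∨-homo x y)) (∨-closed x∈I y∈I)
    ; down-closed = λ x≤y → down-closed (hom-monotone x≤y)
    }
    where open IsIdeal I-ideal

  upward-image : ∀ {p} → Pred L.Carrier p → Pred M.Carrier (a ⊔ ℓb ⊔ p)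
  upward-image F m = ∃[ l ] l ∈ F × ⟦ h ⟧ l M.≤ m

  downward-image : ∀ {p} → Pred L.Carrier p → Pred M.Carrier (a ⊔ ℓb ⊔ p)
  downward-image I m = ∃[ l ] l ∈ I × m M.≤ ⟦ h ⟧ l

  upward-image-isFilter : ∀ {p} {F : Pred L.Carrier p} → IsFilter L F → IsFilter M (upward-image F)
  upward-image-isFilter F-filter = record
    { ⊤∈ = L.⊤ , ⊤∈ , x≤⊤
    ; ∧-closed = λ { (x , x∈F , hx≤m) (y , y∈F , hy≤n) →
        x L.∧ y , ∧-closed x∈F y∈F ,
        ≤-trans (≤-reflexive (h.∧-homo x y)) (∧-monotonic hx≤m hy≤n) }
    ; up-closed = λ { m≤n (x , x∈F , hx≤m) → x , x∈F , ≤-trans hx≤m m≤n }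
    }
    where open IsFilter F-filter

  downward-image-isIdeal : ∀ {p} {I : Pred L.Carrier p} → IsIdeal L I → IsIdeal M (downward-image I)
  downward-image-isIdeal I-ideal = record
    { ⊥∈ = L.⊥ , ⊥∈ , ⊥≤x
    ; ∨-closed = λ { (x , x∈I , m≤hx) (y , y∈I , n≤hy) →
        x L.∨ y , ∨-closed x∈I y∈I ,
        ≤-trans (∨-monotonic m≤hx n≤hy) (≤-reflexive (M.sym (h.∨-homo x y))) }
    ; down-closed = λ { m≤n (x , x∈I , n≤hx) → x , x∈I , ≤-trans m≤n n≤hx }
    }
    where open IsIdeal I-ideal

true-isFilter : IsFilter 𝟚 (_≡ true)
true-isFilter = record
  { ⊤∈ = ≡.refl
  ; ∧-closed = λ { ≡.refl ≡.refl → ≡.refl }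
  ; up-closed = λ { y≡true ≡.refl → y≡true }
  }

false-isIdeal : IsIdeal 𝟚 (_≡ false)
false-isIdeal = record
  { ⊥∈ = ≡.refl
  ; ∨-closed = λ { ≡.refl ≡.refl → ≡.refl }
  ; down-closed = λ { {x} x∧false≡x ≡.refl → ≡.trans (≡.sym x∧false≡x) (Bool.∧-zeroʳ x) }
  }

module _ {a ℓ} {L : BDLattice a ℓ} where
  open BDLattice L using (Carrier; _≤_)

  true-set : L * → Pred Carrier 0ℓ
  true-set x = ⟦ x ⟧ ⊢ (_≡ true)

  false-set : L * → Pred Carrier 0ℓ
  false-set x = ⟦ x ⟧ ⊢ (_≡ false)

  true-set-isFilter : (x : L *) → IsFilter L (true-set x)
  true-set-isFilter x = preimage-isFilter x true-isFilter

  false-set-isIdeal : (x : L *) → IsIdeal L (false-set x)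
  false-set-isIdeal x = preimage-isIdeal x false-isIdeal

  point-monotone : (x : L *) → ∀ {a b} → a ≤ b → ⟦ x ⟧ a ≡ true → ⟦ x ⟧ b ≡ true
  point-monotone x = IsFilter.up-closed (true-set-isFilter x)

  true-set-disjoint-false-set : (x : L *) → ∀ a → a ∈ true-set x → ¬ a ∈ false-set x
  true-set-disjoint-false-set x a xa≡true xa≡false with () ← ≡.trans (≡.sym xa≡true) xa≡false

  ≤*-by-contraposition : {x y : L *} → (∀ a → ⟦ y ⟧ a ≡ false → ⟦ x ⟧ a ≡ false) → x ≤* y
  ≤*-by-contraposition {x} {y} y≡false⇒x≡false a xa≡true with ⟦ y ⟧ a in ya
  ... | true = ≡.refl
  ... | false = ⊥-elim (true-set-disjoint-false-set x a xa≡true (y≡false⇒x≡false a ya))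

  lift-isFilter : ∀ {p} q {F : Pred Carrier p} → IsFilter L F → IsFilter L (λ a → Lift q (F a))
  lift-isFilter q F-filter = record
    { ⊤∈ = lift ⊤∈
    ; ∧-closed = λ a∈F b∈F → lift (∧-closed (lower a∈F) (lower b∈F))
    ; up-closed = λ a≤b a∈F → lift (up-closed a≤b (lower a∈F))
    }
    where open IsFilter F-filter

  lift-isIdeal : ∀ {p} q {I : Pred Carrier p} → IsIdeal L I → IsIdeal L (λ a → Lift q (I a))
  lift-isIdeal q I-ideal = record
    { ⊥∈ = lift ⊥∈
    ; ∨-closed = λ a∈I b∈I → lift (∨-closed (lower a∈I) (lower b∈I))
    ; down-closed = λ a≤b b∈I → lift (down-closed a≤b (lower b∈I))
    }
    where open IsIdeal I-ideal

  -- The prime filter theorem only separates a filter and an ideal of the same level.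
  separate : PrimeFilterTheorem L → ∀ {p q} {F : Pred Carrier p} {I : Pred Carrier q}
           → IsFilter L F → IsIdeal L I → (∀ a → a ∈ F → ¬ a ∈ I)
           → Σ (L *) λ x → (∀ a → a ∈ F → ⟦ x ⟧ a ≡ true) × (∀ a → a ∈ I → ⟦ x ⟧ a ≡ false)
  separate pft {p} {q} F-filter I-ideal disjoint
    with x , F⇒true , I⇒false ← pft _ _ (lift-isFilter q F-filter) (lift-isIdeal p I-ideal)
           (λ a a∈F a∈I → disjoint a (lower a∈F) (lower a∈I))
    = x , (λ a a∈F → F⇒true a (lift a∈F)) , (λ a a∈I → I⇒false a (lift a∈I))

module LaxSquare {a ℓa b ℓb c ℓc d ℓd}
  {A : BDLattice a ℓa} {B : BDLattice b ℓb} {C : BDLattice c ℓc} {D : BDLattice d ℓd}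
  (f : Hom A B) (g : Hom A C) (u : Hom B D) (v : Hom C D) where
  private
    module A = BDLattice A
    module B = BDLattice B
    module C = BDLattice C
    module D = BDLattice D
    module B≤ = LatticeOrder B
    module C≤ = LatticeOrder C
    module D≤ = LatticeOrder D
  open Principal B using (↑-isFilter)
  open Principal C using (↓-isIdeal)

  Interpolant : B.Carrier → C.Carrier → Set (a ⊔ ℓb ⊔ ℓc)
  Interpolant b c = Σ A.Carrier λ a → b B.≤ ⟦ f ⟧ a × ⟦ g ⟧ a C.≤ c

  interpolation⇒images-disjoint : InterpolationProperty f g u v
    → ∀ y z → dual f y ≤* dual g z
    → ∀ e → e ∈ upward-image u (true-set y) → ¬ e ∈ downward-image v (false-set z)
  interpolation⇒images-disjoint interpolate y z f*y≤g*z e (b , yb , ub≤e) (c , zc , e≤vc)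
    with a , b≤fa , ga≤c ← interpolate b c (D≤.≤-trans ub≤e e≤vc)
    = true-set-disjoint-false-set z c
        (point-monotone z ga≤c (f*y≤g*z a (point-monotone y b≤fa yb))) zc

  interpolation⇒dual-interpolation : PrimeFilterTheorem D
    → InterpolationProperty f g u v → DualInterpolationProperty f g u v
  interpolation⇒dual-interpolation pftD interpolate y z f*y≤g*z
    with x , above-u⇒true , below-v⇒false ←
           separate pftD (upward-image-isFilter u (true-set-isFilter y))
             (downward-image-isIdeal v (false-set-isIdeal z))
             (interpolation⇒images-disjoint interpolate y z f*y≤g*z)
    = x , (λ b yb → above-u⇒true _ (b , yb , D≤.≤-refl))
        , ≤*-by-contraposition {x = dual v x} {z} (λ c zc → below-v⇒false _ (c , zc , D≤.≤-refl))

  separating-points : PrimeFilterTheorem B → PrimeFilterTheorem C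
    → ∀ {b c} → ¬ Interpolant b c
    → Σ (B *) λ y → Σ (C *) λ z → dual f y ≤* dual g z × ⟦ y ⟧ b ≡ true × ⟦ z ⟧ c ≡ false
  separating-points pftB pftC {b} {c} no-interpolant
    with y , above-b⇒true , below-f⇒false ←
           separate pftB (↑-isFilter b) (downward-image-isIdeal f (preimage-isIdeal g (↓-isIdeal c)))
             (λ { e b≤e (a , ga≤c , e≤fa) → no-interpolant (a , B≤.≤-trans b≤e e≤fa , ga≤c) })
    with z , above-g⇒true , below-c⇒false ←
           separate pftC (upward-image-isFilter g (preimage-isFilter f (true-set-isFilter y))) (↓-isIdeal c)
             (λ { e (a , yfa , ga≤e) e≤c → true-set-disjoint-false-set y (⟦ f ⟧ a) yfa
                    (below-f⇒false _ (a , C≤.≤-trans ga≤e e≤c , B≤.≤-refl)) })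
    = y , z , (λ a yfa → above-g⇒true _ (a , yfa , C≤.≤-refl))
        , above-b⇒true b B≤.≤-refl , below-c⇒false c C≤.≤-refl

  dual-interpolation⇒interpolation : ExcludedMiddle (a ⊔ ℓb ⊔ ℓc)
    → PrimeFilterTheorem B → PrimeFilterTheorem C
    → DualInterpolationProperty f g u v → InterpolationProperty f g u v
  dual-interpolation⇒interpolation em pftB pftC dual-interpolate b c ub≤vc with em {Interpolant b c}
  ... | yes interpolant = interpolant
  ... | no no-interpolant
    with y , z , f*y≤g*z , yb , zc ← separating-points pftB pftC no-interpolant
    with x , y≤u*x , v*x≤z ← dual-interpolate y z f*y≤g*z
    = ⊥-elim (true-set-disjoint-false-set z c (v*x≤z c (point-monotone x ub≤vc (y≤u*x b yb))) zc)

proposition4p2 :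
    (lem : ∀ {p} → ExcludedMiddle p) →
    ∀ {a ℓa b ℓb c ℓc d ℓd}
      (A : BDLattice a ℓa) (B : BDLattice b ℓb) (C : BDLattice c ℓc) (D : BDLattice d ℓd)
      → PrimeFilterTheorem A → PrimeFilterTheorem B
      → PrimeFilterTheorem C → PrimeFilterTheorem D
      → (g : Hom A C) (f : Hom A B) (v : Hom C D) (u : Hom B D)
      → (u ∘H f) ≤H (v ∘H g)
      → InterpolationProperty f g u v ⇔ DualInterpolationProperty f g u v
proposition4p2 lem A B C D _ pftB pftC pftD g f v u _ =
  mk⇔ (interpolation⇒dual-interpolation pftD) (dual-interpolation⇒interpolation lem pftB pftC)
  where open LaxSquare f g u v
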